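{- The radius-$1$ flip-width of the gem and of the co-gem are at most $2$.
   Context: All graphs are finite, simple. For $A,B\subseteq V(G)$, $G\oplus(A,B)$ is the graph on $V(G)$ in which the adjacency of distinct $u,v$ is toggled exactly when $(u,v)\in(A\times B)\cup(B\times A)$; $G\oplus\mathcal{S}$ applies all flips in a collection $\mathcal{S}$. For a partition $\mathcal{P}$ of $V(G)$, a $\mathcal{P}$-flip is $G\oplus\mathcal{S}$ with all pairs in $\mathcal{S}$ of the form $(X,Y)$, $X,Y\in\mathcal{P}$; a $k$-flip is a $\mathcal{P}$-flip with $|\mathcal{P}|\le k$. Flipper game of radius $r$ and width $k$: $G_0=G$, the runner picks $v_0$; in round $i\ge1$ the flipper announces a $k$-flip $G_i$ of $G$, then the runner (knowing $G_i$) moves to $v_i$ reachable from $v_{i-1}$ by a path of length at most $r$ in $G_{i-1}$. The flipper wins when the runner's position $v_i$ is isolated in $G_i$. The radius-$r$ flip-width is the minimum $k$ such that the flipper has a winning strategy. With $abcd$ an induced path and a fifth vertex $v$: the gem has $v$ adjacent to all of $a,b,c,d$; the co-gem has $v$ isolated. -}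

module Defs where

open import Data.Nat using (ℕ; zero; suc; _≤_)
open import Data.Fin using (Fin; zero; suc; _≟_)
open import Data.Bool using (Bool; true; false; _∨_; _∧_; _xor_; not)
open import Data.List using (List; foldr)
open import Data.Product using (Σ; _×_; _,_)
open import Data.Sum using (_⊎_)
open import Relation.Nullary.Decidable using (⌊_⌋)
open import Relation.Binary.PropositionalEquality using (_≡_)

Adj : ℕ → Set
Adj n = Fin n → Fin n → Bool

-- A k-flip is specified by a labelling p : Fin n → Fin k (the parts of a partition
-- with at most k parts are the fibres of p) and a collection S of pairs of parts.
inFlip : ∀ {k} → Fin k → Fin k → Fin k × Fin k → Bool
inFlip i j (X , Y) = (⌊ i ≟ X ⌋ ∧ ⌊ j ≟ Y ⌋) ∨ (⌊ i ≟ Y ⌋ ∧ ⌊ j ≟ X ⌋)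

applyFlip : ∀ {n k} → Adj n → (Fin n → Fin k) → List (Fin k × Fin k) → Adj n
applyFlip G p S u v =
  not ⌊ u ≟ v ⌋ ∧ foldr (λ XY b → inFlip (p u) (p v) XY xor b) (G u v) S

data Reach {n} (H : Adj n) : ℕ → Fin n → Fin n → Set where
  here : ∀ {r v} → Reach H r v v
  step : ∀ {r u w v} → H u w ≡ true → Reach H r w v → Reach H (suc r) u v

Isolated : ∀ {n} → Adj n → Fin n → Set
Isolated H v = ∀ w → H v w ≡ false

-- Wins k r G H v : in the flipper game of radius r and width k on G, when the
-- previous graph is H (= G_{i-1}) and the runner stands on v (= v_{i-1}),
-- the flipper has a strategy that wins in finitely many rounds.
data Wins {n} (k r : ℕ) (G : Adj n) : Adj n → Fin n → Set where
  win : ∀ {H v} (p : Fin n → Fin k) (S : List (Fin k × Fin k)) →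
        (∀ v′ → Reach H r v v′ →
           Isolated (applyFlip G p S) v′ ⊎ Wins k r G (applyFlip G p S) v′) →
        Wins k r G H v

FlipperWins : ∀ {n} → ℕ → ℕ → Adj n → Set
FlipperWins k r G = ∀ v₀ → Wins k r G G v₀

FlipWidth≤ : ∀ {n} → ℕ → Adj n → ℕ → Set
FlipWidth≤ r G k = Σ ℕ λ k′ → k′ ≤ k × FlipperWins k′ r G

-- vertices: a = 0, b = 1, c = 2, d = 3, v = 4
pattern v0 = zero
pattern v1 = suc zero
pattern v2 = suc (suc zero)
pattern v3 = suc (suc (suc zero))
pattern v4 = suc (suc (suc (suc zero)))

co-gem : Adj 5
co-gem v0 v1 = true
co-gem v1 v0 = true
co-gem v1 v2 = true
co-gem v2 v1 = true
co-gem v2 v3 = true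
co-gem v3 v2 = true
co-gem _ _ = false

isV : Fin 5 → Bool
isV v4 = true
isV _ = false

gem : Adj 5
gem u w = co-gem u w ∨ (isV u xor isV w)

-- A play of the radius-r flipper game is determined by finitely many choices, so a
-- winning strategy can be found by a depth-bounded search of the game tree, where the
-- flipper only tries the flips of a given list. For the gem and the co-gem, four 2-flips each suffice, and every
-- runner is isolated within four rounds, whatever it does.
module Submission where

open import Defs
open import Data.Nat using (ℕ; zero; suc)
open import Data.Nat.Properties using (≤-refl)
open import Data.Fin using (Fin; _≟_; #_)
open import Data.Bool using (Bool; true; false; T; not; _∧_; _∨_)
open import Data.Bool.Properties using (T-≡; T-not-≡; T-∧; T-∨)
open import Data.List using (List; []; _∷_; allFin)
open import Data.Bool.ListAction using (all; any)
open import Data.List.Relation.Unary.All as All using ()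
open import Data.List.Relation.Unary.All.Properties using (all⁺)
open import Data.List.Relation.Unary.Any as Any using ()
open import Data.List.Relation.Unary.Any.Properties using (any⁺; any⁻)
open import Data.List.Membership.Propositional using (lose)
open import Data.List.Membership.Propositional.Properties using (∈-allFin)
open import Data.Vec using (Vec; []; _∷_; lookup)
open import Data.Product using (_×_; _,_; proj₁; proj₂)
open import Data.Sum using (_⊎_; inj₁; inj₂)
open import Function using (_∘_)
open import Function.Bundles using (Equivalence)
open import Relation.Nullary.Decidable using (⌊_⌋; fromWitness)
open import Relation.Nullary.Negation using (¬_; contradiction)
open import Relation.Binary.PropositionalEquality using (refl)

open Equivalence using (to; from)

all-allFin : ∀ {n} (p : Fin n → Bool) → T (all p (allFin n)) → ∀ x → T (p x)
all-allFin p holds x = All.lookup (all⁺ p _ holds) (∈-allFin x)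

any-allFin : ∀ {n} (p : Fin n → Bool) x → T (p x) → T (any p (allFin n))
any-allFin p x px = any⁺ p (lose (∈-allFin x) px)

T-not⇒¬T : ∀ {b} → T (not b) → ¬ T b
T-not⇒¬T {true} ()

Flip : ℕ → ℕ → Set
Flip n k = Vec (Fin k) n × List (Fin k × Fin k)

_⊕_ : ∀ {n k} → Adj n → Flip n k → Adj n
G ⊕ f = applyFlip G (lookup (proj₁ f)) (proj₂ f)

within : ∀ {n} → ℕ → Adj n → Fin n → Fin n → Bool
within zero    H u v = ⌊ u ≟ v ⌋
within (suc r) H u v = ⌊ u ≟ v ⌋ ∨ any (λ w → H u w ∧ within r H w v) (allFin _)

Reach⇒within : ∀ {n} {H : Adj n} {r u v} → Reach H r u v → T (within r H u v)
Reach⇒within {r = zero}          here = fromWitness refl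
Reach⇒within {r = suc r} {u = v} here = from (T-∨ {⌊ v ≟ v ⌋}) (inj₁ (fromWitness refl))
Reach⇒within {H = H} {u = u} {v} (step {w = w} uw ρ) =
  from (T-∨ {⌊ u ≟ v ⌋}) (inj₂ (any-allFin _ w (from (T-∧ {H u w}) (from T-≡ uw , Reach⇒within ρ))))

isolated? : ∀ {n} → Adj n → Fin n → Bool
isolated? H v = all (not ∘ H v) (allFin _)

isolated?-sound : ∀ {n} (H : Adj n) v → T (isolated? H v) → Isolated H v
isolated?-sound H v holds w = to T-not-≡ (all-allFin (not ∘ H v) holds w)

module Search {n k : ℕ} (r : ℕ) (G : Adj n) (flips : List (Flip n k)) where

  winsWithin : ℕ → Adj n → Fin n → Bool
  winsWithin zero    H v = false
  winsWithin (suc d) H v = any (λ f → all (answers f) (allFin n)) flips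
    where
    answers : Flip n k → Fin n → Bool
    answers f v′ = not (within r H v v′) ∨ (isolated? (G ⊕ f) v′ ∨ winsWithin d (G ⊕ f) v′)

  winsWithin-sound : ∀ d H v → T (winsWithin d H v) → Wins k r G H v
  winsWithin-sound (suc d) H v found
    with f , answered ← Any.satisfied (any⁻ _ flips found) =
    win (lookup (proj₁ f)) (proj₂ f) response
    where
    response : ∀ v′ → Reach H r v v′ → Isolated (G ⊕ f) v′ ⊎ Wins k r G (G ⊕ f) v′
    response v′ ρ with to T-∨ (all-allFin _ answered v′)
    ... | inj₁ unreachable = contradiction (Reach⇒within ρ) (T-not⇒¬T unreachable)
    ... | inj₂ answer with to T-∨ answer
    ...   | inj₁ isolated = inj₁ (isolated?-sound (G ⊕ f) v′ isolated)
    ...   | inj₂ wins     = inj₂ (winsWithin-sound d (G ⊕ f) v′ wins)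

  flipperWins : ∀ d → T (all (winsWithin d G) (allFin n)) → FlipperWins k r G
  flipperWins d holds v₀ = winsWithin-sound d G v₀ (all-allFin _ holds v₀)

gemFlips : List (Flip 5 2)
gemFlips =
  (# 0 ∷ # 1 ∷ # 0 ∷ # 1 ∷ # 0 ∷ [] , (# 0 , # 1) ∷ []) ∷
  (# 0 ∷ # 1 ∷ # 0 ∷ # 1 ∷ # 1 ∷ [] , (# 0 , # 1) ∷ (# 1 , # 1) ∷ []) ∷
  (# 0 ∷ # 0 ∷ # 1 ∷ # 1 ∷ # 0 ∷ [] , (# 0 , # 0) ∷ (# 1 , # 1) ∷ []) ∷
  (# 0 ∷ # 0 ∷ # 1 ∷ # 0 ∷ # 1 ∷ [] , (# 0 , # 1) ∷ (# 1 , # 1) ∷ []) ∷ []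

co-gemFlips : List (Flip 5 2)
co-gemFlips =
  (# 0 ∷ # 0 ∷ # 1 ∷ # 1 ∷ # 1 ∷ [] , (# 0 , # 0) ∷ []) ∷
  (# 0 ∷ # 0 ∷ # 1 ∷ # 1 ∷ # 0 ∷ [] , (# 0 , # 0) ∷ (# 1 , # 1) ∷ []) ∷
  (# 0 ∷ # 1 ∷ # 0 ∷ # 1 ∷ # 1 ∷ [] , (# 0 , # 1) ∷ []) ∷
  (# 0 ∷ # 1 ∷ # 1 ∷ # 1 ∷ # 0 ∷ [] , (# 1 , # 1) ∷ []) ∷ []

theorem5p1 : FlipWidth≤ 1 gem 2 × FlipWidth≤ 1 co-gem 2
theorem5p1 =
  (_ , ≤-refl , Search.flipperWins 1 gem gemFlips 4 _) ,
  (_ , ≤-refl , Search.flipperWins 1 co-gem co-gemFlips 4 _)
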